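{- Let $\dot G\in\mathcal C_1\cup\mathcal C_4\cup\mathcal C_5$ be a connected, non-complete, $6$-regular and $2$ net-regular strongly regular signed graph on $n$ vertices with parameters $(n,6,a,b,c)$. If $\dot G$ contains an unbalanced triangle of the second type and $b=1$, then $n\ge 15$.
   Context: Signed graphs. - A signed graph $\dot G=(G,\sigma)$ is a simple graph $G$ (the underlying graph) with a sign function $\sigma:E(G)\to\{\pm1\}$. - The adjacency matrix has entries $\sigma(v_iv_j)$ for adjacent pairs and $0$ otherwise. - Connected, complete and regular refer to $G$. - $\dot G$ is $\rho$ net-regular if every vertex has (number of positive incident edges) $-$ (number of negative incident edges) $=\rho$. - $\dot G$ is homogeneous if all edges have the same sign. Triangles. - An unbalanced triangle of the second type is a triangle all three of whose edges are negative. Strongly regular signed graphs. - An SRSG is a signed graph on $n$ vertices, neither homogeneous complete nor edgeless, for which there are $r\in\mathbb N$ and $a,b,c\in\mathbb Z$ such that the entries of $A(\dot G)^2$ are: - $r$ on the diagonal; - $a$ for pairs joined by a positive edge; - $b$ for pairs joined by a negative edge; - $c$ for distinct non-adjacent pairs. - $(n,r,a,b,c)$ are its parameters. Classes of inhomogeneous SRSGs. - $\mathcal C_1$: $a=-b$, and either complete, or non-complete with $c\ne0$. - $\mathcal C_4$: $a\ne-b$, non-complete, $c=0$. - $\mathcal C_5$: $a\ne-b$, non-complete, $c\ne\frac{a+b}2$ and $c\neq0$. -}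

module Defs where

import Data.Nat
open Data.Nat using (ℕ; zero; suc)
open import Data.Integer using (ℤ; +_; -_; _*_; ∣_∣) renaming (_+_ to _+ℤ_)
open import Data.Fin using (Fin; zero; suc)
open import Data.Product using (Σ; ∃; _×_; _,_)
open import Data.Sum using (_⊎_)
open import Relation.Binary.PropositionalEquality using (_≡_; _≢_)
open import Relation.Nullary using (¬_)

sumℤ : ∀ {n} → (Fin n → ℤ) → ℤ
sumℤ {zero}  f = + 0
sumℤ {suc n} f = f zero +ℤ sumℤ (λ k → f (suc k))

sumℕ : ∀ {n} → (Fin n → ℕ) → ℕ
sumℕ {zero}  f = 0
sumℕ {suc n} f = f zero Data.Nat.+ sumℕ (λ k → f (suc k))

record SignedGraph (n : ℕ) : Set where
  field
    A       : Fin n → Fin n → ℤ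
    entries : ∀ i j → (A i j ≡ + 0) ⊎ (A i j ≡ + 1) ⊎ (A i j ≡ - (+ 1))
    symm    : ∀ i j → A i j ≡ A j i
    loopless : ∀ i → A i i ≡ + 0
open SignedGraph public

module _ {n : ℕ} (G : SignedGraph n) where

  Adjacent : Fin n → Fin n → Set
  Adjacent i j = A G i j ≢ + 0

  PosEdge NegEdge : Fin n → Fin n → Set
  PosEdge i j = A G i j ≡ + 1
  NegEdge i j = A G i j ≡ - (+ 1)

  A² : Fin n → Fin n → ℤ
  A² i j = sumℤ (λ k → A G i k * A G k j)

  degree : Fin n → ℕ
  degree i = sumℕ (λ k → ∣ A G i k ∣)

  netDegree : Fin n → ℤ
  netDegree i = sumℤ (λ k → A G i k)

  Regular : ℕ → Set
  Regular r = ∀ i → degree i ≡ r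

  NetRegular : ℤ → Set
  NetRegular ρ = ∀ i → netDegree i ≡ ρ

  data Reach (i : Fin n) : Fin n → Set where
    here : Reach i i
    step : ∀ {j k} → Reach i j → Adjacent j k → Reach i k

  Connected : Set
  Connected = ∀ i j → Reach i j

  Complete : Set
  Complete = ∀ i j → i ≢ j → Adjacent i j

  Edgeless : Set
  Edgeless = ∀ i j → ¬ Adjacent i j

  Homogeneous : Set
  Homogeneous = (∀ i j → ¬ NegEdge i j) ⊎ (∀ i j → ¬ PosEdge i j)

  record IsSRSG (r : ℕ) (a b c : ℤ) : Set where
    field
      notHomComplete : ¬ (Homogeneous × Complete)
      notEdgeless    : ¬ Edgeless
      diag   : ∀ i → A² i i ≡ + r
      posAdj : ∀ i j → PosEdge i j → A² i j ≡ a
      negAdj : ∀ i j → NegEdge i j → A² i j ≡ b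
      nonAdj : ∀ i j → i ≢ j → ¬ Adjacent i j → A² i j ≡ c

  InC₁ : ℤ → ℤ → ℤ → Set
  InC₁ a b c = ¬ Homogeneous × a ≡ - b × (Complete ⊎ (¬ Complete × c ≢ + 0))

  InC₄ : ℤ → ℤ → ℤ → Set
  InC₄ a b c = ¬ Homogeneous × a ≢ - b × ¬ Complete × c ≡ + 0

  -- c ≠ (a+b)/2 is stated as 2c ≠ a + b
  InC₅ : ℤ → ℤ → ℤ → Set
  InC₅ a b c = ¬ Homogeneous × a ≢ - b × ¬ Complete × (+ 2) * c ≢ a +ℤ b × c ≢ + 0

  -- unbalanced triangle of the second type: all three edges negative
  HasNegTriangle : Set
  HasNegTriangle = Σ (Fin n) λ i → Σ (Fin n) λ j → Σ (Fin n) λ k →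
    NegEdge i j × NegEdge j k × NegEdge i k

module Submission where

open import Defs
open import Data.Nat using (ℕ; _≤_)
open import Data.Integer using (ℤ; +_)
open import Data.Sum using (_⊎_)
open import Relation.Binary.PropositionalEquality using (_≡_)
open import Relation.Nullary using (¬_)

import Data.Nat as ℕ
import Data.Nat.Properties as ℕ
open import Data.Integer using (0ℤ; 1ℤ; -1ℤ; -_; ∣_∣; _+_; _*_; +≤+) renaming (_≤_ to _≤ℤ_; _≤?_ to _≤ℤ?_)
import Data.Integer.Properties as ℤ
open import Algebra.Properties.CommutativeSemigroup ℤ.+-commutativeSemigroup using (interchange)
open import Data.Fin using (Fin; zero; suc; _≟_)
open import Data.Fin.Properties using (all?)
open import Data.Product using (∃; _,_)
open import Data.Sum using (inj₁; inj₂)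
open import Relation.Binary.PropositionalEquality using (_≢_; refl; sym; trans; cong; cong₂; subst; module ≡-Reasoning)
open import Relation.Nullary using (yes; no; contradiction)
open import Relation.Nullary.Decidable using (toWitness)

-- Each of i, j, k in a negative triangle has 4 positive and 2 negative neighbours, the negative
-- ones being the other two triangle vertices. As the third triangle vertex already contributes 1
-- to (A²)_pq = b = 1 for every edge pq of the triangle, the positive neighbourhoods of i, j, k
-- are pairwise disjoint, so n ≥ 3 + 3·4. Instead of counting sets, we sum over all vertices l the
-- weight 2·#positive − 4·#negative − 2·(pairwise products) of (A_il, A_jl, A_kl), plus 12 when l
-- is a triangle vertex: each weight is at most 2 and the total is 30. Of the SRSG axioms only the
-- value b on negative edges is used; the class, connectivity and completeness hypotheses are not.

sumℤ-cong : ∀ {n} {f g : Fin n → ℤ} → (∀ l → f l ≡ g l) → sumℤ f ≡ sumℤ g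
sumℤ-cong {ℕ.zero}  f≗g = refl
sumℤ-cong {ℕ.suc n} f≗g = cong₂ _+_ (f≗g zero) (sumℤ-cong (λ l → f≗g (suc l)))

sumℤ-+ : ∀ {n} (f g : Fin n → ℤ) → sumℤ (λ l → f l + g l) ≡ sumℤ f + sumℤ g
sumℤ-+ {ℕ.zero}  f g = refl
sumℤ-+ {ℕ.suc n} f g =
  trans (cong (_+_ (f zero + g zero)) (sumℤ-+ (λ l → f (suc l)) (λ l → g (suc l))))
        (interchange (f zero) (g zero) _ _)

sumℤ-+₃ : ∀ {n} (f g h : Fin n → ℤ) →
          sumℤ (λ l → f l + g l + h l) ≡ sumℤ f + sumℤ g + sumℤ h
sumℤ-+₃ f g h = trans (sumℤ-+ (λ l → f l + g l) h) (cong (_+ sumℤ h) (sumℤ-+ f g))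

sumℤ-* : ∀ {n} c (f : Fin n → ℤ) → sumℤ (λ l → c * f l) ≡ c * sumℤ f
sumℤ-* {ℕ.zero}  c f = sym (ℤ.*-zeroʳ c)
sumℤ-* {ℕ.suc n} c f =
  trans (cong (_+_ (c * f zero)) (sumℤ-* c (λ l → f (suc l))))
        (sym (ℤ.*-distribˡ-+ c (f zero) _))

sumℤ-zero : ∀ n → sumℤ {n} (λ _ → 0ℤ) ≡ 0ℤ
sumℤ-zero ℕ.zero    = refl
sumℤ-zero (ℕ.suc n) = trans (ℤ.+-identityˡ _) (sumℤ-zero n)

sumℤ-≤ : ∀ {n} (f : Fin n → ℤ) m → (∀ l → f l ≤ℤ + m) → sumℤ f ≤ℤ + (n ℕ.* m)
sumℤ-≤ {ℕ.zero}  f m f≤m = +≤+ ℕ.z≤n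
sumℤ-≤ {ℕ.suc n} f m f≤m = ℤ.+-mono-≤ (f≤m zero) (sumℤ-≤ (λ l → f (suc l)) m (λ l → f≤m (suc l)))

+-sumℕ : ∀ {n} (f : Fin n → ℕ) → + sumℕ f ≡ sumℤ (λ l → + f l)
+-sumℕ {ℕ.zero}  f = refl
+-sumℕ {ℕ.suc n} f = cong (_+_ (+ f zero)) (+-sumℕ (λ l → f (suc l)))

δ : ∀ {n} → Fin n → Fin n → ℤ
δ zero    zero    = 1ℤ
δ zero    (suc _) = 0ℤ
δ (suc _) zero    = 0ℤ
δ (suc p) (suc l) = δ p l

δ-diag : ∀ {n} (p : Fin n) → δ p p ≡ 1ℤ
δ-diag zero    = refl
δ-diag (suc p) = δ-diag p

δ-≢ : ∀ {n} {p l : Fin n} → p ≢ l → δ p l ≡ 0ℤ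
δ-≢ {p = zero}  {zero}  p≢l = contradiction refl p≢l
δ-≢ {p = zero}  {suc l} p≢l = refl
δ-≢ {p = suc p} {zero}  p≢l = refl
δ-≢ {p = suc p} {suc l} p≢l = δ-≢ (λ p≡l → p≢l (cong suc p≡l))

sumℤ-δ : ∀ {n} (p : Fin n) → sumℤ (δ p) ≡ 1ℤ
sumℤ-δ {ℕ.suc n} zero    = cong (_+_ 1ℤ) (sumℤ-zero n)
sumℤ-δ           (suc p) = trans (ℤ.+-identityˡ _) (sumℤ-δ p)

SignedEntry : ℤ → Set
SignedEntry x = (x ≡ + 0) ⊎ (x ≡ + 1) ⊎ (x ≡ - (+ 1))

entryValue : Fin 3 → ℤ
entryValue zero             = 0ℤ
entryValue (suc zero)       = 1ℤ
entryValue (suc (suc zero)) = -1ℤ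

SignedEntry⇒entryValue : ∀ {x} → SignedEntry x → ∃ λ s → entryValue s ≡ x
SignedEntry⇒entryValue (inj₁ refl)        = zero , refl
SignedEntry⇒entryValue (inj₂ (inj₁ refl)) = suc zero , refl
SignedEntry⇒entryValue (inj₂ (inj₂ refl)) = suc (suc zero) , refl

cell : ℤ → ℤ → ℤ
cell x d = + 3 * x + -1ℤ * + ∣ x ∣ + + 12 * d

pairs : ℤ → ℤ → ℤ → ℤ
pairs x y z = x * y + y * z + x * z

weight : (x y z dx dy dz : ℤ) → ℤ
weight x y z dx dy dz = cell x dx + cell y dy + cell z dz + - (+ 2) * pairs x y z

weight-outside : ∀ {x y z} → SignedEntry x → SignedEntry y → SignedEntry z →
                 weight x y z 0ℤ 0ℤ 0ℤ ≤ℤ + 2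
weight-outside ex ey ez
  with SignedEntry⇒entryValue ex | SignedEntry⇒entryValue ey | SignedEntry⇒entryValue ez
... | s , refl | t , refl | u , refl = table s t u
  where
  table : ∀ s t u → weight (entryValue s) (entryValue t) (entryValue u) 0ℤ 0ℤ 0ℤ ≤ℤ + 2
  table = toWitness {a? = all? λ s → all? λ t → all? λ u →
                          weight (entryValue s) (entryValue t) (entryValue u) 0ℤ 0ℤ 0ℤ ≤ℤ? + 2} _

module _ {n} (G : SignedGraph n) where

  NegEdge-sym : ∀ {p q} → NegEdge G p q → NegEdge G q p
  NegEdge-sym {p} {q} e = trans (symm G q p) e

  NegEdge⇒≢ : ∀ {p q} → NegEdge G p q → p ≢ q
  NegEdge⇒≢ {p} e refl with trans (sym e) (loopless G p)
  ... | ()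

  sumℤ-∣A∣ : ∀ {r} → Regular G r → ∀ p → sumℤ (λ l → + ∣ A G p l ∣) ≡ + r
  sumℤ-∣A∣ reg p = trans (sym (+-sumℕ (λ l → ∣ A G p l ∣))) (cong +_ (reg p))

  sumℤ-cell : ∀ {r ρ} → Regular G r → NetRegular G ρ → ∀ p →
              sumℤ (λ l → cell (A G p l) (δ p l)) ≡ + 3 * ρ + -1ℤ * + r + + 12 * 1ℤ
  sumℤ-cell {r} {ρ} reg net p = begin
    sumℤ (λ l → cell (A G p l) (δ p l))
      ≡⟨ sumℤ-+₃ (λ l → + 3 * A G p l) (λ l → -1ℤ * + ∣ A G p l ∣) (λ l → + 12 * δ p l) ⟩
    sumℤ (λ l → + 3 * A G p l) + sumℤ (λ l → -1ℤ * + ∣ A G p l ∣) + sumℤ (λ l → + 12 * δ p l)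
      ≡⟨ cong₂ _+_ (cong₂ _+_ (sumℤ-* (+ 3) (A G p)) (sumℤ-* -1ℤ (λ l → + ∣ A G p l ∣)))
                   (sumℤ-* (+ 12) (δ p)) ⟩
    + 3 * netDegree G p + -1ℤ * sumℤ (λ l → + ∣ A G p l ∣) + + 12 * sumℤ (δ p)
      ≡⟨ cong₂ _+_ (cong₂ _+_ (cong (+ 3 *_) (net p)) (cong (-1ℤ *_) (sumℤ-∣A∣ reg p)))
                   (cong (+ 12 *_) (sumℤ-δ p)) ⟩
    + 3 * ρ + -1ℤ * + r + + 12 * 1ℤ ∎
    where open ≡-Reasoning

  sumℤ-NegEdge : ∀ {r a b c} → IsSRSG G r a b c → ∀ {p q} → NegEdge G p q →
                 sumℤ (λ l → A G p l * A G q l) ≡ b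
  sumℤ-NegEdge srsg {p} {q} e =
    trans (sumℤ-cong (λ l → cong (A G p l *_) (symm G q l))) (IsSRSG.negAdj srsg p q e)

  module _ {i j k} (ij : NegEdge G i j) (jk : NegEdge G j k) (ik : NegEdge G i k) where

    weightAt : Fin n → ℤ
    weightAt l = weight (A G i l) (A G j l) (A G k l) (δ i l) (δ j l) (δ k l)

    weightAt-≤ : ∀ l → weightAt l ≤ℤ + 2
    weightAt-≤ l with i ≟ l | j ≟ l | k ≟ l
    ... | yes refl | _ | _
      rewrite loopless G i | NegEdge-sym ij | NegEdge-sym ik
            | δ-diag i | δ-≢ (NegEdge⇒≢ (NegEdge-sym ij)) | δ-≢ (NegEdge⇒≢ (NegEdge-sym ik))
      = ℤ.≤-refl
    ... | no _ | yes refl | _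
      rewrite ij | loopless G j | NegEdge-sym jk
            | δ-≢ (NegEdge⇒≢ ij) | δ-diag j | δ-≢ (NegEdge⇒≢ (NegEdge-sym jk))
      = ℤ.≤-refl
    ... | no _ | no _ | yes refl
      rewrite ik | jk | loopless G k
            | δ-≢ (NegEdge⇒≢ ik) | δ-≢ (NegEdge⇒≢ jk) | δ-diag k
      = ℤ.≤-refl
    ... | no i≢l | no j≢l | no k≢l
      rewrite δ-≢ i≢l | δ-≢ j≢l | δ-≢ k≢l
      = weight-outside (entries G i l) (entries G j l) (entries G k l)

    sumℤ-weightAt : ∀ {r ρ a b c} → Regular G r → NetRegular G ρ → IsSRSG G r a b c →
                    let s = + 3 * ρ + -1ℤ * + r + + 12 * 1ℤ in
                    sumℤ weightAt ≡ s + s + s + - (+ 2) * (b + b + b)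
    sumℤ-weightAt {r} {ρ} {b = b} reg net srsg = begin
      sumℤ weightAt
        ≡⟨ sumℤ-+ (λ l → cellAt i l + cellAt j l + cellAt k l) (λ l → - (+ 2) * pairsAt l) ⟩
      sumℤ (λ l → cellAt i l + cellAt j l + cellAt k l) + sumℤ (λ l → - (+ 2) * pairsAt l)
        ≡⟨ cong₂ _+_ (sumℤ-+₃ (cellAt i) (cellAt j) (cellAt k)) (sumℤ-* (- (+ 2)) pairsAt) ⟩
      sumℤ (cellAt i) + sumℤ (cellAt j) + sumℤ (cellAt k) + - (+ 2) * sumℤ pairsAt
        ≡⟨ cong₂ _+_ (cong₂ _+_ (cong₂ _+_ (sumℤ-cell reg net i) (sumℤ-cell reg net j))
                                (sumℤ-cell reg net k))
                     (cong (- (+ 2) *_) sumℤ-pairsAt) ⟩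
      s + s + s + - (+ 2) * (b + b + b) ∎
      where
      open ≡-Reasoning
      s : ℤ
      s = + 3 * ρ + -1ℤ * + r + + 12 * 1ℤ
      cellAt : Fin n → Fin n → ℤ
      cellAt p l = cell (A G p l) (δ p l)
      pairsAt : Fin n → ℤ
      pairsAt l = pairs (A G i l) (A G j l) (A G k l)
      sumℤ-pairsAt : sumℤ pairsAt ≡ b + b + b
      sumℤ-pairsAt =
        trans (sumℤ-+₃ (λ l → A G i l * A G j l) (λ l → A G j l * A G k l) (λ l → A G i l * A G k l))
              (cong₂ _+_ (cong₂ _+_ (sumℤ-NegEdge srsg ij) (sumℤ-NegEdge srsg jk)) (sumℤ-NegEdge srsg ik))

lemma3p15 : (n : ℕ) (G : SignedGraph n) (a b c : ℤ) →
    IsSRSG G 6 a b c →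
    (InC₁ G a b c ⊎ InC₄ G a b c ⊎ InC₅ G a b c) →
    Connected G → ¬ Complete G → Regular G 6 → NetRegular G (+ 2) →
    HasNegTriangle G → b ≡ + 1 → 15 ≤ n
lemma3p15 n G a b c srsg _ _ _ reg net (i , j , k , ij , jk , ik) refl =
  ℕ.*-cancelʳ-≤ 15 n 2 (ℤ.drop‿+≤+ 30≤2n)
  where
  30≤2n : + 30 ≤ℤ + (n ℕ.* 2)
  30≤2n = subst (_≤ℤ + (n ℕ.* 2)) (sumℤ-weightAt G ij jk ik reg net srsg)
                (sumℤ-≤ (weightAt G ij jk ik) 2 (weightAt-≤ G ij jk ik))
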